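{- Let $M_G$ be a mixed graph of order $n$ whose rank equals $2$. Then $M_G$ is switching equivalent to $K_{a,b}\cup tK_1$ (an undirected complete bipartite graph together with $t$ isolated vertices) for some integers $a,b\ge1$, $t\ge 0$ with $a+b+t=n$.
   Context: A mixed graph $M_G$ is obtained from a finite simple graph $G$ by orienting the edges of some subset of $E(G)$; simple graphs are mixed graphs without arcs. With $\omega=\frac{1+\mathbf{i}\sqrt3}{2}$, $N(M_G)$ has $(u,v)$-entry $\omega$ if $\overrightarrow{uv}$ is an arc, $\bar\omega$ if $\overrightarrow{vu}$ is an arc, $1$ for an undirected edge, $0$ otherwise; the rank of $M_G$ is the rank of $N(M_G)$. Let $\mathbb{T}_6=\{\pm1,\pm\omega,\pm\bar\omega\}$. Given a partition $V(M_G)=\bigcup_{j\in\mathbb{T}_6}V_j$, an edge $xy$ has type $(j,k)$ if $x\in V_j,y\in V_k$; the partition is admissible if each undirected edge has type $(j,j)$ or $(j,\omega j)$ and each arc has type $(j,j)$, $(j,\bar\omega j)$ or $(j,-\omega j)$ for some $j$. A three-way switching w.r.t. an admissible partition turns undirected edges of type $(j,\omega j)$ into arcs from $V_j$ to $V_{\omega j}$, arcs of type $(j,\bar\omega j)$ into undirected edges, and reverses arcs of type $(j,-\omega j)$. The converse reverses all arcs. Two mixed graphs are switching equivalent if one is obtained from the other (up to isomorphism) by a sequence of three-way switchings and taking converses. -}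

module Defs where

open import Data.Nat as ℕ using (ℕ; zero; suc; _<_; _≤_; _<ᵇ_; _%_; _∸_)
open import Data.Integer as ℤ using (ℤ; +_; -_)
open import Data.Fin as Fin using (Fin; toℕ; punchIn)
open import Data.Bool using (Bool; true; false; _∧_; _∨_; if_then_else_; not)
open import Data.Bool.Properties using (∨-comm)
open import Data.Product using (Σ; ∃; ∃-syntax; _×_; _,_)
open import Data.Sum using (_⊎_)
open import Function.Bundles using (_↔_; Inverse)
open import Relation.Nullary using (¬_)
open import Relation.Binary.PropositionalEquality using (_≡_; refl; cong; sym; trans)
open import Relation.Binary.Construct.Closure.ReflexiveTransitive using (Star)

-- Eisenstein integers ℤ[ω], ω = (1 + i√3)/2, a primitive 6th root of
-- unity, so ω² = ω - 1 and ω̄ = 1 - ω.  The pair (a , b) denotes a + bω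
-- (unique representation, since 1, ω are ℚ-linearly independent).

record ℤω : Set where
  constructor _+_ω
  field
    re : ℤ
    im : ℤ

infixl 6 _⊕_
infixl 7 _⊗_

_⊕_ : ℤω → ℤω → ℤω
(a + b ω) ⊕ (c + d ω) = (a ℤ.+ c) + (b ℤ.+ d) ω

-- (a + bω)(c + dω) = (ac - bd) + (ad + bc + bd)ω   using ω² = ω - 1
_⊗_ : ℤω → ℤω → ℤω
(a + b ω) ⊗ (c + d ω) = (a ℤ.* c ℤ.- b ℤ.* d) + (a ℤ.* d ℤ.+ b ℤ.* c ℤ.+ b ℤ.* d) ω

⊖_ : ℤω → ℤω
⊖ (a + b ω) = (ℤ.- a) + (ℤ.- b) ω

𝟘 𝟙 ω ω̄ : ℤω
𝟘  = (+ 0) + (+ 0) ω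
𝟙  = (+ 1) + (+ 0) ω
ω  = (+ 0) + (+ 1) ω
ω̄  = (+ 1) + (ℤ.- (+ 1)) ω

ΣFin : ∀ {k} → (Fin k → ℤω) → ℤω
ΣFin {zero}  f = 𝟘
ΣFin {suc k} f = f Fin.zero ⊕ ΣFin (λ i → f (Fin.suc i))

sgn : ℕ → ℤω
sgn zero          = 𝟙
sgn (suc zero)    = ⊖ 𝟙
sgn (suc (suc m)) = sgn m

det : ∀ {k} → (Fin k → Fin k → ℤω) → ℤω
det {zero}  A = 𝟙
det {suc k} A =
  ΣFin (λ j → sgn (toℕ j) ⊗ A Fin.zero j ⊗ det (λ i j′ → A (Fin.suc i) (punchIn j j′)))

Injective : ∀ {k n} → (Fin k → Fin n) → Set
Injective f = ∀ x y → f x ≡ f y → x ≡ y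

HasNonzeroMinor : ∀ {m n} → (Fin m → Fin n → ℤω) → ℕ → Set
HasNonzeroMinor {m} {n} A k =
  Σ (Fin k → Fin m) λ r → Σ (Fin k → Fin n) λ c →
    Injective r × Injective c × ¬ (det (λ i j → A (r i) (c j)) ≡ 𝟘)

-- Determinantal rank: the largest size of a nonzero minor.  Over the
-- integral domain ℤ[ω] ⊂ ℂ this is the rank of A as a complex matrix.
HasRank : ∀ {m n} → (Fin m → Fin n → ℤω) → ℕ → Set
HasRank A r = HasNonzeroMinor A r × (∀ k → r < k → ¬ HasNonzeroMinor A k)

-- Mixed graphs on vertex set Fin n.
-- e u v = none       : no edge
--         undirected : undirected edge uv
--         arcOut     : arc u → v
--         arcIn      : arc v → u

data Tag : Set where
  none undirected arcOut arcIn : Tag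

flipT : Tag → Tag
flipT none       = none
flipT undirected = undirected
flipT arcOut     = arcIn
flipT arcIn      = arcOut

record MixedGraph (n : ℕ) : Set where
  field
    e        : Fin n → Fin n → Tag
    loopless : ∀ u → e u u ≡ none
    skew     : ∀ u v → e v u ≡ flipT (e u v)
open MixedGraph public

tagEntry : Tag → ℤω
tagEntry none       = 𝟘
tagEntry undirected = 𝟙
tagEntry arcOut     = ω
tagEntry arcIn      = ω̄

N : ∀ {n} → MixedGraph n → Fin n → Fin n → ℤω
N G u v = tagEntry (e G u v)

rank : ∀ {n} → MixedGraph n → ℕ → Set
rank G r = HasRank (N G) r

-- Partitions indexed by 𝕋₆ = {ω^k : k ∈ ℤ/6}: p u = k means u ∈ V_{ω^k}.
-- (1 = ω⁰, ω = ω¹, -ω̄ = ω², -1 = ω³, -ω = ω⁴, ω̄ = ω⁵.)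
-- For x ∈ V_j, y ∈ V_{j'}:  d x y = k with j' = ω^k j.

d : ∀ {n} → (Fin n → Fin 6) → Fin n → Fin n → ℕ
d p x y = (6 ℕ.+ toℕ (p y) ∸ toℕ (p x)) % 6

-- admissible: undirected edges of type (j,j) or (j,ωj) (in some order:
-- d ∈ {0,1,5}); arcs u→v of type (j,j), (j,ω̄j), (j,-ωj): d u v ∈ {0,5,4}.
Admissible : ∀ {n} → MixedGraph n → (Fin n → Fin 6) → Set
Admissible G p =
  (∀ u v → e G u v ≡ undirected → (d p u v ≡ 0 ⊎ d p u v ≡ 1 ⊎ d p u v ≡ 5)) ×
  (∀ u v → e G u v ≡ arcOut → (d p u v ≡ 0 ⊎ d p u v ≡ 5 ⊎ d p u v ≡ 4))

switchTag : ℕ → Tag → Tag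
switchTag k none = none
-- undirected edge of type (j,ωj) becomes an arc from V_j to V_{ωj}
switchTag 1 undirected = arcOut
switchTag 5 undirected = arcIn
switchTag k undirected = undirected
-- arc u → v of type (j,ω̄j) becomes undirected, of type (j,-ωj) reversed
switchTag 5 arcOut = undirected
switchTag 4 arcOut = arcIn
switchTag k arcOut = arcOut
-- arc v → u: (v,u) has d = 6 - k
switchTag 1 arcIn = undirected
switchTag 2 arcIn = arcOut
switchTag k arcIn = arcIn

ThreeWaySwitch : ∀ {n} → MixedGraph n → MixedGraph n → Set
ThreeWaySwitch {n} G H =
  Σ (Fin n → Fin 6) λ p → Admissible G p ×
    (∀ u v → e H u v ≡ switchTag (d p u v) (e G u v))

Converse : ∀ {n} → MixedGraph n → MixedGraph n → Set
Converse G H = ∀ u v → e H u v ≡ flipT (e G u v)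

Isomorphic : ∀ {n} → MixedGraph n → MixedGraph n → Set
Isomorphic {n} G H =
  Σ (Fin n ↔ Fin n) λ σ → ∀ u v → e H (Inverse.to σ u) (Inverse.to σ v) ≡ e G u v

data Step {n} (G H : MixedGraph n) : Set where
  switch : ThreeWaySwitch G H → Step G H
  conv   : Converse G H → Step G H
  iso    : Isomorphic G H → Step G H

SymStep : ∀ {n} → MixedGraph n → MixedGraph n → Set
SymStep G H = Step G H ⊎ Step H G

SwitchingEquivalent : ∀ {n} → MixedGraph n → MixedGraph n → Set
SwitchingEquivalent = Star SymStep

sideA sideB : ∀ {n} → ℕ → ℕ → Fin n → Bool
sideA a b u = toℕ u <ᵇ a
sideB a b u = (not (toℕ u <ᵇ a)) ∧ (toℕ u <ᵇ a ℕ.+ b)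

crossing : ∀ {n} → ℕ → ℕ → Fin n → Fin n → Bool
crossing a b u v = (sideA a b u ∧ sideB a b v) ∨ (sideA a b v ∧ sideB a b u)

private
  boolTag : Bool → Tag
  boolTag true  = undirected
  boolTag false = none


  cross-loop : ∀ {n} a b (u : Fin n) → crossing a b u u ≡ false
  cross-loop a b u with toℕ u <ᵇ a
  ... | true  = refl
  ... | false = refl

  cross-sym : ∀ {n} a b (u v : Fin n) → crossing a b v u ≡ crossing a b u v
  cross-sym a b u v = ∨-comm (sideA a b v ∧ sideB a b u) (sideA a b u ∧ sideB a b v)

  flip-bool : ∀ x → boolTag x ≡ flipT (boolTag x)
  flip-bool true  = refl
  flip-bool false = refl

CompleteBipartitePlusIsolated : (n a b : ℕ) → MixedGraph n
CompleteBipartitePlusIsolated n a b = record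
  { e        = λ u v → boolTag (crossing a b u v)
  ; loopless = λ u → cong boolTag (cross-loop a b u)
  ; skew     = λ u v → trans (cong boolTag (cross-sym a b u v)) (flip-bool (crossing a b u v))
  }

-- Fix an edge xy.  Every 3×3 minor of N on rows x, y, u and columns x, y, v vanishes (by the
-- rank bound, or because a row or column repeats), and these minors involve only the six
-- entries among x, y, u, v.  Exhausting those entries shows: each vertex is adjacent to y
-- (left side), or to x but not y (right side), or to neither (isolated); a vertex on the left
-- is adjacent to exactly the vertices on the right; and the three-way switching with
-- potential ω^{p w} = N_wx on the right and N_wy N_yx on the left is admissible and makes
-- every edge undirected.  Sorting the vertices by side identifies the switched graph with
-- K_{a,b} ∪ tK₁, where a, b ≥ 1 because x is on the left and y on the right.
module Submission where

open import Defs
open import Data.Nat using (ℕ; _+_; _≥_)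
open import Data.Product using (Σ; _×_)
open import Relation.Binary.PropositionalEquality using (_≡_)

open import Data.Bool using (Bool; true; false)
open import Data.Empty using (⊥-elim)
open import Data.Fin as Fin using (Fin; zero; suc; toℕ; punchIn; fromℕ<)
open import Data.Fin.Permutation using (Permutation′; id; insert; insert-punchIn; _⟨$⟩ʳ_)
open import Data.Fin.Properties using (inj⇒≟; all?; any?; toℕ-fromℕ<)
open import Data.Nat as ℕ using (suc; _<ᵇ_; _≤_; _%_; _∸_; s≤s)
open import Data.Nat.DivMod using (_mod_)
open import Data.Nat.Properties using (suc-injective; +-suc; m≤m+n; ≤-trans; ≤-refl)
open import Data.Integer.Properties as ℤ using ()
open import Data.Product using (∃₂; _,_; proj₁; proj₂)
open import Data.Sum using (_⊎_; inj₁)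
open import Data.Unit using (tt)
open import Data.Vec using (Vec; []; _∷_; lookup)
open import Data.Vec.Relation.Unary.All using ([]; _∷_)
open import Data.Vec.Relation.Unary.AllPairs using ([]; _∷_)
open import Data.Vec.Relation.Unary.Unique.Propositional.Properties using (lookup-injective)
open import Function using (_∘_; _$_)
open import Function.Bundles using (_↣_; mk↣)
open import Relation.Binary.Construct.Closure.ReflexiveTransitive using (ε; _◅_)
open import Relation.Binary.Definitions using (DecidableEquality)
open import Relation.Binary.PropositionalEquality using (_≢_; refl; sym; trans; cong; cong₂; subst)
open import Relation.Nullary using (¬_)
open import Relation.Nullary.Decidable
  using (Dec; yes; no; map′; _×-dec_; _⊎-dec_; _→-dec_; ¬?; toWitness; decidable-stable)

-- Deciding statements about finitely many tags

tagCode : Tag → Fin 4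
tagCode none       = zero
tagCode undirected = suc zero
tagCode arcOut     = suc (suc zero)
tagCode arcIn      = suc (suc (suc zero))

codeTag : Fin 4 → Tag
codeTag zero                   = none
codeTag (suc zero)             = undirected
codeTag (suc (suc zero))       = arcOut
codeTag (suc (suc (suc zero))) = arcIn

codeTag-tagCode : ∀ t → codeTag (tagCode t) ≡ t
codeTag-tagCode none       = refl
codeTag-tagCode undirected = refl
codeTag-tagCode arcOut     = refl
codeTag-tagCode arcIn      = refl

tag↣Fin4 : Tag ↣ Fin 4
tag↣Fin4 = mk↣ λ {s} {t} eq →
  trans (sym (codeTag-tagCode s)) (trans (cong codeTag eq) (codeTag-tagCode t))

infix 4 _≟ᵗ_ _≟ω_

_≟ᵗ_ : DecidableEquality Tag
_≟ᵗ_ = inj⇒≟ tag↣Fin4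

∀-tag? : {P : Tag → Set} → (∀ t → Dec (P t)) → Dec (∀ t → P t)
∀-tag? {P} P? =
  map′ (λ h t → subst P (codeTag-tagCode t) (h (tagCode t))) (λ h i → h (codeTag i))
       (all? (P? ∘ codeTag))

_≟ω_ : DecidableEquality ℤω
(a + b ω) ≟ω (c + d ω) =
  map′ (λ (a≡c , b≡d) → cong₂ _+_ω a≡c b≡d) (λ eq → cong ℤω.re eq , cong ℤω.im eq)
       (a ℤ.≟ c ×-dec b ℤ.≟ d)

ΣFin-cong : ∀ {k} {f g : Fin k → ℤω} → (∀ i → f i ≡ g i) → ΣFin f ≡ ΣFin g
ΣFin-cong {ℕ.zero} h = refl
ΣFin-cong {suc k}  h = cong₂ _⊕_ (h zero) (ΣFin-cong (h ∘ suc))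

det-cong : ∀ {k} {A B : Fin k → Fin k → ℤω} → (∀ i j → A i j ≡ B i j) → det A ≡ det B
det-cong {ℕ.zero} h = refl
det-cong {suc k}  h = ΣFin-cong λ j →
  cong₂ (λ a m → sgn (toℕ j) ⊗ a ⊗ m) (h zero j) (det-cong λ i j′ → h (suc i) (punchIn j j′))

minor-vanishes : ∀ {m n k} {A : Fin m → Fin n → ℤω} → ¬ HasNonzeroMinor A k →
  ∀ {r c} → Injective r → Injective c → det (λ i j → A (r i) (c j)) ≡ 𝟘
minor-vanishes noMinor {r} {c} r-inj c-inj =
  decidable-stable (_ ≟ω 𝟘) λ det≢𝟘 → noMinor (r , c , r-inj , c-inj , det≢𝟘)

-- The local configuration around an edge xy

-- The minor of N on rows x, y, u and columns x, y, v, where a = e x y, xu = e x u, …,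
-- uv = e u v; looplessness and skew symmetry fix the remaining entries.
localMatrix : (a xu yu xv yv uv : Tag) → Fin 3 → Fin 3 → ℤω
localMatrix a xu yu xv yv uv i j = tagEntry (lookup (lookup rows i) j)
  where
  rows : Vec (Vec Tag 3) 3
  rows = (none     ∷ a        ∷ xv ∷ [])
       ∷ (flipT a  ∷ none     ∷ yv ∷ [])
       ∷ (flipT xu ∷ flipT yu ∷ uv ∷ [])
       ∷ []

-- A record rather than an equation, so that unification recovers the six tags without
-- unfolding det.
record Vanishes (a xu yu xv yv uv : Tag) : Set where
  constructor vanishing
  field
    det≡𝟘 : det (localMatrix a xu yu xv yv uv) ≡ 𝟘

vanishes? : ∀ a xu yu xv yv uv → Dec (Vanishes a xu yu xv yv uv)
vanishes? a xu yu xv yv uv =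
  map′ vanishing Vanishes.det≡𝟘 (det (localMatrix a xu yu xv yv uv) ≟ω 𝟘)

vanishes-row₃≡row₁ : ∀ a xv yv → Vanishes a none (flipT a) xv yv xv
vanishes-row₃≡row₁ = toWitness {a? = ∀-tag? λ a → ∀-tag? λ xv → ∀-tag? λ yv →
  vanishes? a none (flipT a) xv yv xv} tt

vanishes-row₃≡row₂ : ∀ a xv yv → Vanishes a a none xv yv yv
vanishes-row₃≡row₂ = toWitness {a? = ∀-tag? λ a → ∀-tag? λ xv → ∀-tag? λ yv →
  vanishes? a a none xv yv yv} tt

vanishes-col₃≡col₁ : ∀ a xu yu → Vanishes a xu yu none (flipT a) (flipT xu)
vanishes-col₃≡col₁ = toWitness {a? = ∀-tag? λ a → ∀-tag? λ xu → ∀-tag? λ yu →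
  vanishes? a xu yu none (flipT a) (flipT xu)} tt

vanishes-col₃≡col₂ : ∀ a xu yu → Vanishes a xu yu a none (flipT yu)
vanishes-col₃≡col₂ = toWitness {a? = ∀-tag? λ a → ∀-tag? λ xu → ∀-tag? λ yu →
  vanishes? a xu yu a none (flipT yu)} tt

vanishes-resp : ∀ {a xu xu′ yu yu′ xv xv′ yv yv′ uv uv′} →
  xu ≡ xu′ → yu ≡ yu′ → xv ≡ xv′ → yv ≡ yv′ → uv ≡ uv′ →
  Vanishes a xu yu xv yv uv → Vanishes a xu′ yu′ xv′ yv′ uv′
vanishes-resp refl refl refl refl refl h = h

data Side : Set where
  left right apart : Side

side : (xw yw : Tag) → Side
side xw         undirected = left
side xw         arcOut     = left
side xw         arcIn      = left
side none       none       = apart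
side undirected none       = right
side arcOut     none       = right
side arcIn      none       = right

side-left : ∀ xw a → a ≢ none → side xw (flipT a) ≡ left
side-left xw none       a≢none = ⊥-elim (a≢none refl)
side-left xw undirected _      = refl
side-left xw arcOut     _      = refl
side-left xw arcIn      _      = refl

side-right : ∀ a → a ≢ none → side a none ≡ right
side-right none       a≢none = ⊥-elim (a≢none refl)
side-right undirected _      = refl
side-right arcOut     _      = refl
side-right arcIn      _      = refl

-- tagEntry t = ω ^ exponent t whenever t ≢ none
exponent : Tag → ℕ
exponent none       = 0
exponent undirected = 0
exponent arcOut     = 1
exponent arcIn      = 5

potential : (a xw yw : Tag) → Fin 6
potential a xw yw = onSide (side xw yw)
  where
  onSide : Side → Fin 6
  onSide left  = (exponent (flipT yw) + exponent (flipT a)) mod 6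
  onSide right = exponent (flipT xw) mod 6
  onSide apart = zero

shift : Fin 6 → Fin 6 → ℕ
shift i j = (6 + toℕ j ∸ toℕ i) % 6

bipartiteTag : Side → Side → Tag
bipartiteTag left  right = undirected
bipartiteTag right left  = undirected
bipartiteTag _     _     = none

AdmissibleAt : ℕ → Tag → Set
AdmissibleAt k t =
  (t ≡ undirected → k ≡ 0 ⊎ k ≡ 1 ⊎ k ≡ 5) × (t ≡ arcOut → k ≡ 0 ⊎ k ≡ 5 ⊎ k ≡ 4)

SwitchesTo : ℕ → Tag → Tag → Set
SwitchesTo k t t′ = AdmissibleAt k t × t′ ≡ switchTag k t

switchesTo? : ∀ k t t′ → Dec (SwitchesTo k t t′)
switchesTo? k t t′ =
  (((t ≟ᵗ undirected) →-dec (k ℕ.≟ 0 ⊎-dec k ℕ.≟ 1 ⊎-dec k ℕ.≟ 5))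
    ×-dec ((t ≟ᵗ arcOut) →-dec (k ℕ.≟ 0 ⊎-dec k ℕ.≟ 5 ⊎-dec k ℕ.≟ 4)))
  ×-dec t′ ≟ᵗ switchTag k t

LocalSwitch : (a xu yu xv yv uv : Tag) → Set
LocalSwitch a xu yu xv yv uv =
  a ≢ none →
  Vanishes a xu yu xu yu none → Vanishes a xv yv xv yv none → Vanishes a xu yu xv yv uv →
  SwitchesTo (shift (potential a xu yu) (potential a xv yv)) uv
             (bipartiteTag (side xu yu) (side xv yv))

localSwitch? : ∀ a xu yu xv yv uv → Dec (LocalSwitch a xu yu xv yv uv)
localSwitch? a xu yu xv yv uv =
  ¬? (a ≟ᵗ none) →-dec vanishes? a xu yu xu yu none →-dec vanishes? a xv yv xv yv none
  →-dec vanishes? a xu yu xv yv uv →-dec switchesTo? _ uv _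

localSwitch : ∀ a xu yu xv yv uv → LocalSwitch a xu yu xv yv uv
localSwitch = toWitness {a? = ∀-tag? λ a → ∀-tag? λ xu → ∀-tag? λ yu → ∀-tag? λ xv →
  ∀-tag? λ yv → ∀-tag? λ uv → localSwitch? a xu yu xv yv uv} tt

bipartiteTag-loopless : ∀ s → bipartiteTag s s ≡ none
bipartiteTag-loopless left  = refl
bipartiteTag-loopless right = refl
bipartiteTag-loopless apart = refl

bipartiteTag-skew : ∀ s s′ → bipartiteTag s′ s ≡ flipT (bipartiteTag s s′)
bipartiteTag-skew left  left  = refl
bipartiteTag-skew left  right = refl
bipartiteTag-skew left  apart = refl
bipartiteTag-skew right left  = refl
bipartiteTag-skew right right = refl
bipartiteTag-skew right apart = refl
bipartiteTag-skew apart left  = refl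
bipartiteTag-skew apart right = refl
bipartiteTag-skew apart apart = refl

bipartiteGraph : ∀ {n} → (Fin n → Side) → MixedGraph n
bipartiteGraph s = record
  { e        = λ u v → bipartiteTag (s u) (s v)
  ; loopless = λ u → bipartiteTag-loopless (s u)
  ; skew     = λ u v → bipartiteTag-skew (s u) (s v)
  }

threeWaySwitch : ∀ {n} {G H : MixedGraph n} (p : Fin n → Fin 6) →
  (∀ u v → SwitchesTo (d p u v) (e G u v) (e H u v)) → ThreeWaySwitch G H
threeWaySwitch p h =
  p , ((λ u v → proj₁ (proj₁ (h u v))) , (λ u v → proj₂ (proj₁ (h u v)))) , λ u v → proj₂ (h u v)

module AlongEdge {n} (G : MixedGraph n) (x y : Fin n) (xy : e G x y ≢ none)
                 (noMinor₃ : ¬ HasNonzeroMinor (N G) 3) where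

  a : Tag
  a = e G x y

  x≢y : x ≢ y
  x≢y refl = xy (loopless G x)

  frame : Fin n → Fin 3 → Fin n
  frame u = lookup (x ∷ y ∷ u ∷ [])

  frame-injective : ∀ {u} → x ≢ u → y ≢ u → Injective (frame u)
  frame-injective x≢u y≢u = lookup-injective ((x≢y ∷ x≢u ∷ []) ∷ (y≢u ∷ []) ∷ [] ∷ [])

  VanishesAt : Fin n → Fin n → Set
  VanishesAt u v = Vanishes a (e G x u) (e G y u) (e G x v) (e G y v) (e G u v)

  frame≗localMatrix : ∀ u v i j → N G (frame u i) (frame v j) ≡
    localMatrix a (e G x u) (e G y u) (e G x v) (e G y v) (e G u v) i j
  frame≗localMatrix u v zero             zero             = cong tagEntry (loopless G x)
  frame≗localMatrix u v zero             (suc zero)       = refl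
  frame≗localMatrix u v zero             (suc (suc zero)) = refl
  frame≗localMatrix u v (suc zero)       zero             = cong tagEntry (skew G x y)
  frame≗localMatrix u v (suc zero)       (suc zero)             = cong tagEntry (loopless G y)
  frame≗localMatrix u v (suc zero)       (suc (suc zero))       = refl
  frame≗localMatrix u v (suc (suc zero)) zero             = cong tagEntry (skew G x u)
  frame≗localMatrix u v (suc (suc zero)) (suc zero)             = cong tagEntry (skew G y u)
  frame≗localMatrix u v (suc (suc zero)) (suc (suc zero))       = refl

  vanishesAt : ∀ u v → VanishesAt u v
  vanishesAt u v with x Fin.≟ u | y Fin.≟ u | x Fin.≟ v | y Fin.≟ v
  ... | yes refl | _ | _ | _ =
    vanishes-resp (sym (loopless G x)) (sym (skew G x y)) refl refl refl
      (vanishes-row₃≡row₁ a (e G x v) (e G y v))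
  ... | no _ | yes refl | _ | _ =
    vanishes-resp refl (sym (loopless G y)) refl refl refl
      (vanishes-row₃≡row₂ a (e G x v) (e G y v))
  ... | no _ | no _ | yes refl | _ =
    vanishes-resp refl refl (sym (loopless G x)) (sym (skew G x y)) (sym (skew G x u))
      (vanishes-col₃≡col₁ a (e G x u) (e G y u))
  ... | no _ | no _ | no _ | yes refl =
    vanishes-resp refl refl refl (sym (loopless G y)) (sym (skew G y u))
      (vanishes-col₃≡col₂ a (e G x u) (e G y u))
  ... | no x≢u | no y≢u | no x≢v | no y≢v = vanishing $
    trans (sym (det-cong (frame≗localMatrix u v)))
          (minor-vanishes {A = N G} noMinor₃ {frame u} {frame v}
            (frame-injective x≢u y≢u) (frame-injective x≢v y≢v))

  vanishesAt-diagonal : ∀ u → Vanishes a (e G x u) (e G y u) (e G x u) (e G y u) none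
  vanishesAt-diagonal u = vanishes-resp refl refl refl refl (loopless G u) (vanishesAt u u)

  sideOf : Fin n → Side
  sideOf w = side (e G x w) (e G y w)

  potentialOf : Fin n → Fin 6
  potentialOf w = potential a (e G x w) (e G y w)

  switching : ThreeWaySwitch G (bipartiteGraph sideOf)
  switching = threeWaySwitch {G = G} {H = bipartiteGraph sideOf} potentialOf λ u v →
    localSwitch a (e G x u) (e G y u) (e G x v) (e G y v) (e G u v)
      xy (vanishesAt-diagonal u) (vanishesAt-diagonal v) (vanishesAt u v)

  sideOf-x : sideOf x ≡ left
  sideOf-x = trans (cong (side (e G x x)) (skew G x y)) (side-left (e G x x) a xy)

  sideOf-y : sideOf y ≡ right
  sideOf-y = trans (cong (side a) (loopless G y)) (side-right a xy)

-- Arranging the vertices in the order of K_{a,b} ∪ tK₁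

blockSide : (lefts rights position : ℕ) → Side
blockSide (suc A)  B       ℕ.zero  = left
blockSide (suc A)  B       (suc m) = blockSide A B m
blockSide ℕ.zero   (suc B) ℕ.zero  = right
blockSide ℕ.zero   (suc B) (suc m) = blockSide ℕ.zero B m
blockSide ℕ.zero   ℕ.zero  m       = apart

classify : Bool → Bool → Side
classify true  _     = left
classify false true  = right
classify false false = apart

blockSide-classify : ∀ A B m → blockSide A B m ≡ classify (m <ᵇ A) (m <ᵇ A + B)
blockSide-classify (suc A)  B       ℕ.zero  = refl
blockSide-classify (suc A)  B       (suc m) = blockSide-classify A B m
blockSide-classify ℕ.zero   (suc B) ℕ.zero  = refl
blockSide-classify ℕ.zero   (suc B) (suc m) = blockSide-classify ℕ.zero B m
blockSide-classify ℕ.zero   ℕ.zero  m       = refl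

completeBipartite-edge : ∀ {n} A B (i j : Fin n) →
  e (CompleteBipartitePlusIsolated n A B) i j ≡
  bipartiteTag (blockSide A B (toℕ i)) (blockSide A B (toℕ j))
completeBipartite-edge A B i j
  rewrite blockSide-classify A B (toℕ i) | blockSide-classify A B (toℕ j)
  with toℕ i <ᵇ A | toℕ i <ᵇ A + B | toℕ j <ᵇ A | toℕ j <ᵇ A + B
... | true  | _     | true  | _     = refl
... | true  | _     | false | true  = refl
... | true  | _     | false | false = refl
... | false | true  | true  | _     = refl
... | false | false | true  | _     = refl
... | false | true  | false | true  = refl
... | false | true  | false | false = refl
... | false | false | false | true  = refl
... | false | false | false | false = refl

blockSide≡left⇒A≥1 : ∀ A B m → blockSide A B m ≡ left → A ≥ 1
blockSide≡left⇒A≥1 (suc A)  B       m       _  = s≤s ℕ.z≤n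
blockSide≡left⇒A≥1 ℕ.zero   (suc B) (suc m) eq = blockSide≡left⇒A≥1 ℕ.zero B m eq

blockSide≡right⇒B≥1 : ∀ A B m → blockSide A B m ≡ right → B ≥ 1
blockSide≡right⇒B≥1 (suc A)  B       (suc m) eq = blockSide≡right⇒B≥1 A B m eq
blockSide≡right⇒B≥1 ℕ.zero   (suc B) m       _  = s≤s ℕ.z≤n

blockSide-firstRight : ∀ A B → blockSide A (suc B) A ≡ right
blockSide-firstRight ℕ.zero  B = refl
blockSide-firstRight (suc A) B = blockSide-firstRight A B

blockSide-firstApart : ∀ A B → blockSide A B (A + B) ≡ apart
blockSide-firstApart (suc A) B       = blockSide-firstApart A B
blockSide-firstApart ℕ.zero  (suc B) = blockSide-firstApart ℕ.zero B
blockSide-firstApart ℕ.zero  ℕ.zero  = refl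

blockSide-punchIn-right : ∀ {m} A B (k : Fin (suc m)) (i : Fin m) → toℕ k ≡ A →
  blockSide A (suc B) (toℕ (punchIn k i)) ≡ blockSide A B (toℕ i)
blockSide-punchIn-right ℕ.zero  B zero    i       _  = refl
blockSide-punchIn-right (suc A) B (suc k) zero    _  = refl
blockSide-punchIn-right (suc A) B (suc k) (suc i) eq =
  blockSide-punchIn-right A B k i (suc-injective eq)

blockSide-punchIn-apart : ∀ {m} A B (k : Fin (suc m)) (i : Fin m) → toℕ k ≡ A + B →
  blockSide A B (toℕ (punchIn k i)) ≡ blockSide A B (toℕ i)
blockSide-punchIn-apart ℕ.zero  ℕ.zero  k       i       _  = refl
blockSide-punchIn-apart (suc A) B       (suc k) zero    _  = refl
blockSide-punchIn-apart (suc A) B       (suc k) (suc i) eq =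
  blockSide-punchIn-apart A B k i (suc-injective eq)
blockSide-punchIn-apart ℕ.zero  (suc B) (suc k) zero    _  = refl
blockSide-punchIn-apart ℕ.zero  (suc B) (suc k) (suc i) eq =
  blockSide-punchIn-apart ℕ.zero B k i (suc-injective eq)

record Arrangement {n} (s : Fin n → Side) : Set where
  field
    lefts rights aparts : ℕ
    total               : lefts + rights + aparts ≡ n
    σ                   : Permutation′ n
    arranged            : ∀ u → blockSide lefts rights (toℕ (σ ⟨$⟩ʳ u)) ≡ s u

insertAt : ∀ {n} {s : Fin (suc n) → Side} (r : Arrangement (s ∘ suc))
  (A B T : ℕ) (k : Fin (suc n)) → A + B + T ≡ suc n → blockSide A B (toℕ k) ≡ s zero →
  (∀ i → blockSide A B (toℕ (punchIn k i)) ≡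
         blockSide (Arrangement.lefts r) (Arrangement.rights r) (toℕ i)) →
  Arrangement s
insertAt {s = s} r A B T k total placed shifted = record
  { lefts = A ; rights = B ; aparts = T ; total = total ; σ = insert zero k σ ; arranged = arranged′ }
  where
  open Arrangement r using (σ; arranged)
  arranged′ : ∀ u → blockSide A B (toℕ (insert zero k σ ⟨$⟩ʳ u)) ≡ s u
  arranged′ zero    = placed
  arranged′ (suc u) = trans (cong (blockSide A B ∘ toℕ) (insert-punchIn zero k σ u))
                            (trans (shifted (σ ⟨$⟩ʳ u)) (arranged u))

arrange : ∀ {n} (s : Fin n → Side) → Arrangement s
arrange {ℕ.zero} s = record
  { lefts = 0 ; rights = 0 ; aparts = 0 ; total = refl ; σ = id ; arranged = λ () }
arrange {suc n} s with arrange (s ∘ suc) | s zero in s₀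
... | r | left = insertAt r (suc lefts) rights aparts zero (cong suc total) (sym s₀) λ _ → refl
  where open Arrangement r
... | r | right =
  insertAt r lefts (suc rights) aparts k
    (trans (cong (_+ aparts) (+-suc lefts rights)) (cong suc total))
    (trans (cong (blockSide lefts (suc rights)) k≡lefts)
           (trans (blockSide-firstRight lefts rights) (sym s₀)))
    λ i → blockSide-punchIn-right lefts rights k i k≡lefts
  where
  open Arrangement r
  lefts<1+n : lefts ℕ.< suc n
  lefts<1+n =
    s≤s (subst (lefts ≤_) total (≤-trans (m≤m+n lefts rights) (m≤m+n (lefts + rights) aparts)))
  k : Fin (suc n)
  k = fromℕ< lefts<1+n
  k≡lefts : toℕ k ≡ lefts
  k≡lefts = toℕ-fromℕ< lefts<1+n
... | r | apart =
  insertAt r lefts rights (suc aparts) k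
    (trans (+-suc (lefts + rights) aparts) (cong suc total))
    (trans (cong (blockSide lefts rights) k≡lefts+rights)
           (trans (blockSide-firstApart lefts rights) (sym s₀)))
    λ i → blockSide-punchIn-apart lefts rights k i k≡lefts+rights
  where
  open Arrangement r
  lefts+rights<1+n : lefts + rights ℕ.< suc n
  lefts+rights<1+n = s≤s (subst (lefts + rights ≤_) total (m≤m+n (lefts + rights) aparts))
  k : Fin (suc n)
  k = fromℕ< lefts+rights<1+n
  k≡lefts+rights : toℕ k ≡ lefts + rights
  k≡lefts+rights = toℕ-fromℕ< lefts+rights<1+n

arranged-isomorphic : ∀ {n} {s : Fin n → Side} (r : Arrangement s) →
  Isomorphic (bipartiteGraph s)
             (CompleteBipartitePlusIsolated n (Arrangement.lefts r) (Arrangement.rights r))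
arranged-isomorphic r = σ , λ u v →
  trans (completeBipartite-edge lefts rights (σ ⟨$⟩ʳ u) (σ ⟨$⟩ʳ v))
        (cong₂ bipartiteTag (arranged u) (arranged v))
  where open Arrangement r

nonzeroMinor⇒edge : ∀ {n} (G : MixedGraph n) → HasNonzeroMinor (N G) 2 → ∃₂ λ x y → e G x y ≢ none
nonzeroMinor⇒edge G (r , c , _ , _ , det≢𝟘)
  with any? (λ x → any? λ y → ¬? (e G x y ≟ᵗ none))
... | yes (x , y , xy) = x , y , xy
... | no noEdge = ⊥-elim (det≢𝟘 (det-cong λ i j → cong tagEntry (none-everywhere (r i) (c j))))
  where
  none-everywhere : ∀ u v → e G u v ≡ none
  none-everywhere u v = decidable-stable (e G u v ≟ᵗ none) λ uv → noEdge (u , v , uv)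

theorem5p9 : (n : ℕ) (G : MixedGraph n) → rank G 2 →
    Σ ℕ λ a → Σ ℕ λ b → Σ ℕ λ t →
      a ≥ 1 × b ≥ 1 × a + b + t ≡ n ×
      SwitchingEquivalent G (CompleteBipartitePlusIsolated n a b)
theorem5p9 n G (minor₂ , noLargerMinor) with nonzeroMinor⇒edge G minor₂
... | x , y , xy =
  lefts , rights , aparts ,
  blockSide≡left⇒A≥1 lefts rights (toℕ (σ ⟨$⟩ʳ x)) (trans (arranged x) sideOf-x) ,
  blockSide≡right⇒B≥1 lefts rights (toℕ (σ ⟨$⟩ʳ y)) (trans (arranged y) sideOf-y) ,
  total ,
  switchStep ◅ isoStep ◅ ε
  where
  open AlongEdge G x y xy (noLargerMinor 3 ≤-refl)
  arrangement : Arrangement sideOf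
  arrangement = arrange sideOf
  open Arrangement arrangement
  switchStep : SymStep G (bipartiteGraph sideOf)
  switchStep = inj₁ (switch switching)
  isoStep : SymStep (bipartiteGraph sideOf) (CompleteBipartitePlusIsolated n lefts rights)
  isoStep = inj₁ (iso (arranged-isomorphic arrangement))
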